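{- Let $G$ be a graph and $v\in V(G)$. If $\beta(v;G)=0$ (equivalently, $\alpha(v;G)=|M_G(\emptyset,\{v\})|$), then \[ |M_G|=|M_{G-v}|+\alpha(v;G)=|M_{G-v}|+\sum_{p\in N(v)}|M_{G-(N[v]\cup N[p])}|. \]
   Context: Graphs are finite and simple; $N(v)$, $N[v]$ are open/closed neighbourhoods and $G-S$ is the subgraph induced by $V(G)\setminus S$. An induced matching is a matching whose endpoints induce a $1$-regular subgraph; it is maximal if not properly contained in another induced matching. $M_H$ is the set of maximal induced matchings of $H$ (if $H$ has no edges, $|M_H|=1$). $M_G(\emptyset,\{v\})$ is the set of maximal induced matchings of $G$ covering $v$. $\alpha(v;G)$ is the number of $M\in M_G(\emptyset,\{v\})$ such that removing from $M$ the edge containing $v$ yields an induced matching that is not maximal in $G-v$; $\beta(v;G)$ is the number of $M\in M_G(\emptyset,\{v\})$ for which the resulting matching is maximal in $G-v$. -}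

module Defs where

open import Data.Bool using (Bool; true; false; _∧_; _∨_; not; _xor_)
open import Data.Nat using (ℕ; zero; suc; _+_; _≡ᵇ_)
open import Data.Fin using (Fin; _≟_)
open import Data.Vec using (Vec; []; _∷_; lookup; tabulate)
open import Data.List using (List; []; _∷_; map; concatMap; length; filterᵇ; allFin)
open import Data.Bool.ListAction using (all; any)
open import Data.Nat.ListAction using (sum)
open import Relation.Nullary.Decidable using (⌊_⌋)
open import Relation.Binary.PropositionalEquality using (_≡_)

record Graph (n : ℕ) : Set where
  field
    adj    : Fin n → Fin n → Bool
    sym    : ∀ i j → adj i j ≡ adj j i
    irrefl : ∀ i → adj i i ≡ false
open Graph public

VSet : ℕ → Set
VSet n = Vec Bool n

_∈ᵇ_ : ∀ {n} → Fin n → VSet n → Bool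
i ∈ᵇ U = lookup U i

_=ᶠ_ : ∀ {n} → Fin n → Fin n → Bool
i =ᶠ j = ⌊ i ≟ j ⌋

-- Sets of (unordered) vertex pairs: symmetric Boolean matrices;
-- M contains the pair {i,j} iff entry (i,j) (equivalently (j,i)) is true.
ESet : ℕ → Set
ESet n = Vec (Vec Bool n) n

_∋ₑ_,_ : ∀ {n} → ESet n → Fin n → Fin n → Bool
M ∋ₑ i , j = lookup (lookup M i) j

vecs : ∀ {A : Set} → List A → (n : ℕ) → List (Vec A n)
vecs xs zero    = [] ∷ []
vecs xs (suc n) = concatMap (λ x → map (x ∷_) (vecs xs n)) xs

allESets : (n : ℕ) → List (ESet n)
allESets n = vecs (vecs (true ∷ false ∷ []) n) n

countE : ∀ {n} → (ESet n → Bool) → ℕ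
countE {n} P = length (filterᵇ P (allESets n))

module _ {n : ℕ} (G : Graph n) where

  -- The complement V(G) \ S, i.e. the vertex set of G - S.
  minus : VSet n → VSet n
  minus S = tabulate (λ i → not (i ∈ᵇ S))

  isEdgeSetIn : VSet n → ESet n → Bool
  isEdgeSetIn U M = all (λ i → all (λ j →
        not ((M ∋ₑ i , j) xor (M ∋ₑ j , i))
      ∧ (not (M ∋ₑ i , j) ∨ (adj G i j ∧ (i ∈ᵇ U) ∧ (j ∈ᵇ U))))
      (allFin n)) (allFin n)

  covered : ESet n → Fin n → Bool
  covered M i = any (λ j → M ∋ₑ i , j) (allFin n)

  degIn : ESet n → Fin n → ℕ
  degIn M i = length (filterᵇ (λ j → covered M j ∧ adj G i j) (allFin n))

  -- M is an induced matching of G[U]: M ⊆ E(G[U]) and G[V(M)] is 1-regular.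
  -- (G[V(M)] being 1-regular forces M to be a matching whose edges are
  -- exactly the edges of G[V(M)].)
  isInducedMatching : VSet n → ESet n → Bool
  isInducedMatching U M =
    isEdgeSetIn U M ∧ all (λ i → not (covered M i) ∨ (degIn M i ≡ᵇ 1)) (allFin n)

  _⊂ₑ_ : ESet n → ESet n → Bool
  M ⊂ₑ M' =
      all (λ i → all (λ j → not (M ∋ₑ i , j) ∨ (M' ∋ₑ i , j)) (allFin n)) (allFin n)
    ∧ any (λ i → any (λ j → (M' ∋ₑ i , j) ∧ not (M ∋ₑ i , j)) (allFin n)) (allFin n)

  isMaxIM : VSet n → ESet n → Bool
  isMaxIM U M = isInducedMatching U M
    ∧ all (λ M' → not (isInducedMatching U M' ∧ (M ⊂ₑ M'))) (allESets n)

  numMIM : VSet n → ℕ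
  numMIM U = countE (isMaxIM U)

  allV : VSet n
  allV = tabulate (λ _ → true)

  numMIM-G : ℕ
  numMIM-G = numMIM allV

  single : Fin n → VSet n
  single v = tabulate (λ i → i =ᶠ v)

  closedN : Fin n → VSet n
  closedN v = tabulate (λ i → (i =ᶠ v) ∨ adj G v i)

  _∪ᵥ_ : VSet n → VSet n → VSet n
  A ∪ᵥ B = tabulate (λ i → (i ∈ᵇ A) ∨ (i ∈ᵇ B))

  removeAt : Fin n → ESet n → ESet n
  removeAt v M = tabulate (λ i → tabulate (λ j →
    (M ∋ₑ i , j) ∧ not (i =ᶠ v) ∧ not (j =ᶠ v)))

  inMv : Fin n → ESet n → Bool
  inMv v M = isMaxIM allV M ∧ covered M v

  numMv : Fin n → ℕ
  numMv v = countE (inMv v)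

  α : Fin n → ℕ
  α v = countE (λ M → inMv v M ∧ not (isMaxIM (minus (single v)) (removeAt v M)))

  β : Fin n → ℕ
  β v = countE (λ M → inMv v M ∧ isMaxIM (minus (single v)) (removeAt v M))

  sumTerm : Fin n → ℕ
  sumTerm v = sum (map (λ p → numMIM (minus (closedN v ∪ᵥ closedN p)))
                       (filterᵇ (adj G v) (allFin n)))

-- Split the maximal induced matchings of G according to whether they cover v.
-- Those covering v through the edge vp correspond bijectively, by deleting
-- that edge, to the maximal induced matchings of G - (N[v] ∪ N[p]); this holds
-- for every graph.  Those not covering v are maximal in G - v, and a maximal
-- induced matching M of G - v fails to be maximal in G only if some edge vp
-- extends it, in which case M + vp is a matching counted by β(v;G).  Hence
-- β(v;G) = 0 makes the second class exactly M_{G-v}, while the first class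
-- has size α(v;G) + β(v;G).
module Submission where

open import Defs hiding (sym)
open import Data.Bool using (Bool; true; false; _∧_; _∨_; not; _xor_; if_then_else_)
open import Data.Bool.ListAction using (all; any)
open import Data.Bool.Properties using (T-≡; ∧-zeroʳ) renaming (_≟_ to _≟ᵇ_)
open import Data.Empty using (⊥; ⊥-elim)
open import Data.Fin using (Fin; _≟_) renaming (zero to fzero; suc to fsuc)
open import Data.List using (List; []; _∷_; _++_; map; concat; concatMap; length; filterᵇ; allFin)
open import Data.List.Properties using (map-cong; map-tabulate)
open import Data.Nat using (ℕ; suc; _+_; _≤_; _<_; z≤n; s≤s; _≡ᵇ_)
open import Data.Nat.ListAction using (sum)
open import Data.Nat.Properties using (+-assoc; +-comm; +-mono-≤; ≤⇒≯; ≡ᵇ⇒≡; ≡⇒≡ᵇ; +-commutativeSemigroup)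
open import Algebra.Properties.CommutativeSemigroup +-commutativeSemigroup using (interchange)
open import Data.Product using (∃; ∃₂; _×_; _,_; proj₁; proj₂)
open import Data.Sum using (_⊎_; inj₁; inj₂)
open import Data.Vec using (Vec; lookup; tabulate) renaming ([] to []ᵛ; _∷_ to _∷ᵛ_)
open import Data.Vec.Properties using (lookup∘tabulate; tabulate∘lookup; tabulate-cong; ≡-dec)
open import Function using (_∘_; id; Equivalence)
open import Relation.Binary.Definitions using (DecidableEquality)
open import Relation.Binary.PropositionalEquality
open import Relation.Nullary using (¬_; Dec; yes; no; does)
open import Relation.Nullary.Decidable using (dec-true; dec-false; isYes≗does; toWitness; fromWitness)

bool-clash : ∀ {b} → b ≡ true → b ≡ false → ⊥
bool-clash refl ()

true⇔true⇒≡ : ∀ {a b} → (a ≡ true → b ≡ true) → (b ≡ true → a ≡ true) → a ≡ b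
true⇔true⇒≡ {false} {false} _  _  = refl
true⇔true⇒≡ {false} {true}  _  b⇒a = b⇒a refl
true⇔true⇒≡ {true}          a⇒b _  = sym (a⇒b refl)

∧-true⁻ˡ : ∀ {a b} → a ∧ b ≡ true → a ≡ true
∧-true⁻ˡ {true} _ = refl

∧-true⁻ʳ : ∀ {a b} → a ∧ b ≡ true → b ≡ true
∧-true⁻ʳ {true} h = h

∧-true⁺ : ∀ {a b} → a ≡ true → b ≡ true → a ∧ b ≡ true
∧-true⁺ refl refl = refl

∨-true⁺ˡ : ∀ {a b} → a ≡ true → a ∨ b ≡ true
∨-true⁺ˡ refl = refl

∨-true⁺ʳ : ∀ {a b} → b ≡ true → a ∨ b ≡ true
∨-true⁺ʳ {true}  _ = refl
∨-true⁺ʳ {false} h = h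

∨-true⁻ : ∀ {a b} → a ∨ b ≡ true → a ≡ true ⊎ b ≡ true
∨-true⁻ {true}  _ = inj₁ refl
∨-true⁻ {false} h = inj₂ h

not-true⁻ : ∀ {a} → not a ≡ true → a ≡ false
not-true⁻ {false} _ = refl

⇒-true⁻ : ∀ {a c} → not a ∨ c ≡ true → a ≡ true → c ≡ true
⇒-true⁻ h refl = h

⇒-true⁺ : ∀ {a c} → (a ≡ true → c ≡ true) → not a ∨ c ≡ true
⇒-true⁺ {false} _   = refl
⇒-true⁺ {true}  a⇒c = a⇒c refl

xnor-true⁻ : ∀ {a b} → not (a xor b) ≡ true → a ≡ b
xnor-true⁻ {false} {false} _ = refl
xnor-true⁻ {true}  {true}  _ = refl

xnor-true⁺ : ∀ {a b} → a ≡ b → not (a xor b) ≡ true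
xnor-true⁺ {false} refl = refl
xnor-true⁺ {true}  refl = refl

¬true⇒false : ∀ {b} → ¬ b ≡ true → b ≡ false
¬true⇒false {false} _  = refl
¬true⇒false {true}  ¬t = ⊥-elim (¬t refl)

∨-false⁻ : ∀ {a b} → a ∨ b ≡ false → a ≡ false × b ≡ false
∨-false⁻ {false} h = refl , h

∨-false⁺ : ∀ {a b} → a ≡ false → b ≡ false → a ∨ b ≡ false
∨-false⁺ refl refl = refl

does-true⁻ : ∀ {P : Set} (P? : Dec P) → does P? ≡ true → P
does-true⁻ (yes p) _ = p

module _ {n : ℕ} {i j : Fin n} where

  =ᶠ⇒≡ : i =ᶠ j ≡ true → i ≡ j
  =ᶠ⇒≡ h = toWitness {a? = i ≟ j} (Equivalence.from T-≡ h)

  ≡⇒=ᶠ : i ≡ j → i =ᶠ j ≡ true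
  ≡⇒=ᶠ e = Equivalence.to T-≡ (fromWitness {a? = i ≟ j} e)

  ≢⇒=ᶠ-false : ¬ i ≡ j → i =ᶠ j ≡ false
  ≢⇒=ᶠ-false i≢j = trans (isYes≗does (i ≟ j)) (dec-false (i ≟ j) i≢j)

  =ᶠ-false⇒≢ : i =ᶠ j ≡ false → ¬ i ≡ j
  =ᶠ-false⇒≢ h i≡j = bool-clash (≡⇒=ᶠ i≡j) h

=ᶠ-refl : ∀ {n} (i : Fin n) → i =ᶠ i ≡ true
=ᶠ-refl i = ≡⇒=ᶠ refl

-- Counting and summing over lists

indicator : Bool → ℕ
indicator true  = 1
indicator false = 0

module _ {A : Set} where

  count : (A → Bool) → List A → ℕ
  count P xs = length (filterᵇ P xs)

  count-∷ : ∀ (P : A → Bool) x xs → count P (x ∷ xs) ≡ indicator (P x) + count P xs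
  count-∷ P x xs with P x
  ... | true  = refl
  ... | false = refl

  count≡sum : ∀ (P : A → Bool) xs → count P xs ≡ sum (map (indicator ∘ P) xs)
  count≡sum P []       = refl
  count≡sum P (x ∷ xs) = trans (count-∷ P x xs) (cong (indicator (P x) +_) (count≡sum P xs))

  sum-map-cong : ∀ {f g : A → ℕ} → (∀ x → f x ≡ g x) → ∀ xs → sum (map f xs) ≡ sum (map g xs)
  sum-map-cong f≗g xs = cong sum (map-cong f≗g xs)

  sum-map-zero : ∀ xs → sum (map (λ (_ : A) → 0) xs) ≡ 0
  sum-map-zero []       = refl
  sum-map-zero (_ ∷ xs) = sum-map-zero xs

  sum-map-+ : ∀ (f g : A → ℕ) xs →
              sum (map (λ x → f x + g x) xs) ≡ sum (map f xs) + sum (map g xs)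
  sum-map-+ f g []       = refl
  sum-map-+ f g (x ∷ xs) = trans (cong (f x + g x +_) (sum-map-+ f g xs))
                                 (interchange (f x) (g x) _ _)

  sum-map-filterᵇ : ∀ (P : A → Bool) (f : A → ℕ) xs →
                    sum (map f (filterᵇ P xs)) ≡ sum (map (λ x → if P x then f x else 0) xs)
  sum-map-filterᵇ P f []       = refl
  sum-map-filterᵇ P f (x ∷ xs) with P x
  ... | true  = cong (f x +_) (sum-map-filterᵇ P f xs)
  ... | false = sum-map-filterᵇ P f xs

  count-cong : ∀ {P Q : A → Bool} → (∀ x → P x ≡ Q x) → ∀ xs → count P xs ≡ count Q xs
  count-cong {P} {Q} P≗Q xs = begin
    count P xs                      ≡⟨ count≡sum P xs ⟩
    sum (map (indicator ∘ P) xs)    ≡⟨ sum-map-cong (cong indicator ∘ P≗Q) xs ⟩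
    sum (map (indicator ∘ Q) xs)    ≡⟨ count≡sum Q xs ⟨
    count Q xs                      ∎
    where open ≡-Reasoning

  count-false : ∀ {P : A → Bool} → (∀ x → P x ≡ false) → ∀ xs → count P xs ≡ 0
  count-false P≗false []       = refl
  count-false {P} P≗false (x ∷ xs) =
    trans (count-∷ P x xs) (cong₂ _+_ (cong indicator (P≗false x)) (count-false P≗false xs))

  count-mono : ∀ {P Q : A → Bool} → (∀ x → P x ≡ true → Q x ≡ true) →
               ∀ xs → count P xs ≤ count Q xs
  count-mono P⇒Q []       = z≤n
  count-mono {P} {Q} P⇒Q (x ∷ xs) rewrite count-∷ P x xs | count-∷ Q x xs =
    +-mono-≤ (indicator-mono (P⇒Q x)) (count-mono P⇒Q xs)
    where
    indicator-mono : ∀ {a b} → (a ≡ true → b ≡ true) → indicator a ≤ indicator b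
    indicator-mono {false} _   = z≤n
    indicator-mono {true}  a⇒b rewrite a⇒b refl = s≤s z≤n

  count-split : ∀ (P Q : A → Bool) xs →
                count P xs ≡ count (λ x → P x ∧ Q x) xs + count (λ x → P x ∧ not (Q x)) xs
  count-split P Q xs = begin
    count P xs
      ≡⟨ count≡sum P xs ⟩
    sum (map (indicator ∘ P) xs)
      ≡⟨ sum-map-cong (λ x → indicator-split (P x) (Q x)) xs ⟩
    sum (map (λ x → indicator (P x ∧ Q x) + indicator (P x ∧ not (Q x))) xs)
      ≡⟨ sum-map-+ _ _ xs ⟩
    sum (map (λ x → indicator (P x ∧ Q x)) xs) + sum (map (λ x → indicator (P x ∧ not (Q x))) xs)
      ≡⟨ cong₂ _+_ (count≡sum _ xs) (count≡sum _ xs) ⟨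
    count (λ x → P x ∧ Q x) xs + count (λ x → P x ∧ not (Q x)) xs
      ∎
    where
    open ≡-Reasoning
    indicator-split : ∀ a b → indicator a ≡ indicator (a ∧ b) + indicator (a ∧ not b)
    indicator-split false _     = refl
    indicator-split true  false = refl
    indicator-split true  true  = refl

  count-filterᵇ : ∀ (P Q : A → Bool) xs → count Q (filterᵇ P xs) ≡ count (λ x → P x ∧ Q x) xs
  count-filterᵇ P Q []       = refl
  count-filterᵇ P Q (x ∷ xs) rewrite count-∷ (λ x → P x ∧ Q x) x xs with P x
  ... | true  = trans (count-∷ Q x _) (cong (indicator (Q x) +_) (count-filterᵇ P Q xs))
  ... | false = count-filterᵇ P Q xs

  count-const-∧ : ∀ b (Q : A → Bool) xs → count (λ x → b ∧ Q x) xs ≡ (if b then count Q xs else 0)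
  count-const-∧ true  Q xs = refl
  count-const-∧ false Q xs = count-false (λ _ → refl) xs

  count-++ : ∀ (P : A → Bool) xs ys → count P (xs ++ ys) ≡ count P xs + count P ys
  count-++ P []       ys = refl
  count-++ P (x ∷ xs) ys = begin
    count P (x ∷ xs ++ ys)                      ≡⟨ count-∷ P x (xs ++ ys) ⟩
    indicator (P x) + count P (xs ++ ys)        ≡⟨ cong (indicator (P x) +_) (count-++ P xs ys) ⟩
    indicator (P x) + (count P xs + count P ys) ≡⟨ +-assoc (indicator (P x)) _ _ ⟨
    indicator (P x) + count P xs + count P ys   ≡⟨ cong (_+ count P ys) (count-∷ P x xs) ⟨
    count P (x ∷ xs) + count P ys               ∎
    where open ≡-Reasoning

module _ {A B : Set} where

  sum-map-swap : ∀ (h : A → B → ℕ) xs ys →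
                 sum (map (λ x → sum (map (h x) ys)) xs) ≡ sum (map (λ y → sum (map (λ x → h x y) xs)) ys)
  sum-map-swap h []       ys = sym (sum-map-zero ys)
  sum-map-swap h (x ∷ xs) ys =
    trans (cong (sum (map (h x) ys) +_) (sum-map-swap h xs ys)) (sym (sum-map-+ (h x) _ ys))

  count-map : ∀ (P : B → Bool) (f : A → B) xs → count P (map f xs) ≡ count (P ∘ f) xs
  count-map P f []       = refl
  count-map P f (x ∷ xs) = begin
    count P (f x ∷ map f xs)                 ≡⟨ count-∷ P (f x) (map f xs) ⟩
    indicator (P (f x)) + count P (map f xs) ≡⟨ cong (indicator (P (f x)) +_) (count-map P f xs) ⟩
    indicator (P (f x)) + count (P ∘ f) xs   ≡⟨ count-∷ (P ∘ f) x xs ⟨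
    count (P ∘ f) (x ∷ xs)                   ∎
    where open ≡-Reasoning

  count-concatMap : ∀ (P : B → Bool) (f : A → List B) xs →
                    count P (concatMap f xs) ≡ sum (map (λ x → count P (f x)) xs)
  count-concatMap P f []       = refl
  count-concatMap P f (x ∷ xs) =
    trans (count-++ P (f x) (concat (map f xs))) (cong (count P (f x) +_) (count-concatMap P f xs))

  -- Double counting of the pairs (x , p) with P x and Q p x.
  count-partition : ∀ (P : A → Bool) (Q : B → A → Bool) xs ps →
                    (∀ x → P x ≡ true → count (λ p → Q p x) ps ≡ 1) →
                    count P xs ≡ sum (map (λ p → count (λ x → P x ∧ Q p x) xs) ps)
  count-partition P Q xs ps unique = begin
    count P xs
      ≡⟨ count≡sum P xs ⟩
    sum (map (indicator ∘ P) xs)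
      ≡⟨ sum-map-cong fibre xs ⟩
    sum (map (λ x → sum (map (λ p → indicator (P x ∧ Q p x)) ps)) xs)
      ≡⟨ sum-map-swap (λ x p → indicator (P x ∧ Q p x)) xs ps ⟩
    sum (map (λ p → sum (map (λ x → indicator (P x ∧ Q p x)) xs)) ps)
      ≡⟨ sum-map-cong (λ p → count≡sum (λ x → P x ∧ Q p x) xs) ps ⟨
    sum (map (λ p → count (λ x → P x ∧ Q p x) xs) ps)
      ∎
    where
    open ≡-Reasoning
    fibre : ∀ x → indicator (P x) ≡ sum (map (λ p → indicator (P x ∧ Q p x)) ps)
    fibre x with P x in Px
    ... | true  = sym (trans (sym (count≡sum (λ p → Q p x) ps)) (unique x Px))
    ... | false = sym (sum-map-zero ps)

-- Enumerations

module _ {A : Set} (eq? : DecidableEquality A) where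

  occurrences : A → List A → ℕ
  occurrences x = count (λ y → does (eq? y x))

  record Enumerates (xs : List A) : Set where
    constructor enumerates
    field once : ∀ x → occurrences x xs ≡ 1

open Enumerates

all⁺ : ∀ {A : Set} {p : A → Bool} → (∀ x → p x ≡ true) → ∀ xs → all p xs ≡ true
all⁺ p≗true []       = refl
all⁺ p≗true (x ∷ xs) rewrite p≗true x = all⁺ p≗true xs

any⁻ : ∀ {A : Set} {p : A → Bool} xs → any p xs ≡ true → ∃ λ x → p x ≡ true
any⁻ {p = p} (x ∷ xs) h with p x in px
... | true  = x , px
... | false = any⁻ xs h

module _ {A : Set} {eq? : DecidableEquality A} {xs : List A} (enum : Enumerates eq? xs) where

  all⁻ : ∀ {p : A → Bool} → all p xs ≡ true → ∀ x → p x ≡ true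
  all⁻ {p} h x = go xs h (once enum x)
    where
    go : ∀ ys → all p ys ≡ true → occurrences eq? x ys ≡ 1 → p x ≡ true
    go (y ∷ ys) h x-once with p y in py | eq? y x
    ... | true | yes refl = py
    ... | true | no _     = go ys h x-once

  any⁺ : ∀ {p : A → Bool} x → p x ≡ true → any p xs ≡ true
  any⁺ {p} x px = go xs (once enum x)
    where
    go : ∀ ys → occurrences eq? x ys ≡ 1 → any p ys ≡ true
    go (y ∷ ys) x-once with eq? y x
    ... | yes refl rewrite px = refl
    ... | no _ with p y
    ...   | true  = refl
    ...   | false = go ys x-once

  count≡0⇒false : ∀ {P : A → Bool} → count P xs ≡ 0 → ∀ x → P x ≡ false
  count≡0⇒false {P} none x with P x in Px
  ... | false = refl
  ... | true  = ⊥-elim (≤⇒≯ (subst (1 ≤_) none (subst (_≤ count P xs) (once enum x) (count-mono at-x xs)))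
                            (s≤s z≤n))
    where
    at-x : ∀ y → does (eq? y x) ≡ true → P y ≡ true
    at-x y h rewrite does-true⁻ (eq? y x) h = Px

  count-unique : ∀ (P : A → Bool) x → P x ≡ true → (∀ y → P y ≡ true → y ≡ x) → count P xs ≡ 1
  count-unique P x Px unique = trans (count-cong P≗x xs) (once enum x)
    where
    P≗x : ∀ y → P y ≡ does (eq? y x)
    P≗x y = true⇔true⇒≡ (λ Py → dec-true (eq? y x) (unique y Py))
                         (λ h → subst (λ z → P z ≡ true) (sym (does-true⁻ (eq? y x) h)) Px)

  count≡1⇒unique : ∀ (P : A → Bool) → count P xs ≡ 1 → ∀ {x y} → P x ≡ true → P y ≡ true → x ≡ y
  count≡1⇒unique P single {x} {y} Px Py with eq? x y
  ... | yes x≡y = x≡y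
  ... | no  x≢y = ⊥-elim (≤⇒≯ (subst (_≤ count P xs) two (count-mono x-or-y xs))
                             (subst (_< 2) (sym single) (s≤s (s≤s z≤n))))
    where
    x-or-y : ∀ z → does (eq? z x) ∨ does (eq? z y) ≡ true → P z ≡ true
    x-or-y z h with ∨-true⁻ {does (eq? z x)} h
    ... | inj₁ z≡x = subst (λ w → P w ≡ true) (sym (does-true⁻ (eq? z x) z≡x)) Px
    ... | inj₂ z≡y = subst (λ w → P w ≡ true) (sym (does-true⁻ (eq? z y) z≡y)) Py
    only-x : ∀ z → (does (eq? z x) ∨ does (eq? z y)) ∧ does (eq? z x) ≡ does (eq? z x)
    only-x z with eq? z x
    ... | yes _ = refl
    ... | no  _ = ∧-zeroʳ _
    only-y : ∀ z → (does (eq? z x) ∨ does (eq? z y)) ∧ not (does (eq? z x)) ≡ does (eq? z y)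
    only-y z with eq? z x | eq? z y
    ... | yes refl | yes refl = ⊥-elim (x≢y refl)
    ... | yes _    | no  _    = refl
    ... | no  _    | yes _    = refl
    ... | no  _    | no  _    = refl
    two : count (λ z → does (eq? z x) ∨ does (eq? z y)) xs ≡ 2
    two = trans (count-split _ (λ z → does (eq? z x)) xs)
                (cong₂ _+_ (trans (count-cong only-x xs) (once enum x)) (trans (count-cong only-y xs) (once enum y)))

  -- Both sides equal the number of pairs (x , y) with P x and y = f x, equivalently Q y and x = g y.
  count-bijection : ∀ (P Q : A → Bool) (f g : A → A) →
                    (∀ x → P x ≡ true → Q (f x) ≡ true) → (∀ y → Q y ≡ true → P (g y) ≡ true) →
                    (∀ x → P x ≡ true → g (f x) ≡ x) → (∀ y → Q y ≡ true → f (g y) ≡ y) →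
                    count P xs ≡ count Q xs
  count-bijection P Q f g PQ QP gf fg = begin
    count P xs
      ≡⟨ count≡sum P xs ⟩
    sum (map (indicator ∘ P) xs)
      ≡⟨ sum-map-cong P-fibre xs ⟩
    sum (map (λ x → sum (map (λ y → indicator (P x ∧ does (eq? y (f x)))) xs)) xs)
      ≡⟨ sum-map-swap (λ x y → indicator (P x ∧ does (eq? y (f x)))) xs xs ⟩
    sum (map (λ y → sum (map (λ x → indicator (P x ∧ does (eq? y (f x)))) xs)) xs)
      ≡⟨ sum-map-cong (λ y → sum-map-cong (λ x → cong indicator (graph x y)) xs) xs ⟩
    sum (map (λ y → sum (map (λ x → indicator (Q y ∧ does (eq? x (g y)))) xs)) xs)
      ≡⟨ sum-map-cong Q-fibre xs ⟨
    sum (map (indicator ∘ Q) xs)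
      ≡⟨ count≡sum Q xs ⟨
    count Q xs
      ∎
    where
    open ≡-Reasoning
    fibre : ∀ b (h : A) → indicator b ≡ sum (map (λ y → indicator (b ∧ does (eq? y h))) xs)
    fibre b h = begin
      indicator b                                          ≡⟨ lemma b ⟩
      (if b then count (λ y → does (eq? y h)) xs else 0)   ≡⟨ count-const-∧ b _ xs ⟨
      count (λ y → b ∧ does (eq? y h)) xs                  ≡⟨ count≡sum _ xs ⟩
      sum (map (λ y → indicator (b ∧ does (eq? y h))) xs)  ∎
      where
      lemma : ∀ b → indicator b ≡ (if b then occurrences eq? h xs else 0)
      lemma true  = sym (once enum h)
      lemma false = refl
    P-fibre : ∀ x → indicator (P x) ≡ sum (map (λ y → indicator (P x ∧ does (eq? y (f x)))) xs)
    P-fibre x = fibre (P x) (f x)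
    Q-fibre : ∀ y → indicator (Q y) ≡ sum (map (λ x → indicator (Q y ∧ does (eq? x (g y)))) xs)
    Q-fibre y = fibre (Q y) (g y)
    graph : ∀ x y → P x ∧ does (eq? y (f x)) ≡ Q y ∧ does (eq? x (g y))
    graph x y = true⇔true⇒≡ to from
      where
      to : P x ∧ does (eq? y (f x)) ≡ true → Q y ∧ does (eq? x (g y)) ≡ true
      to h with does-true⁻ (eq? y (f x)) (∧-true⁻ʳ h)
      ... | refl = ∧-true⁺ (PQ x (∧-true⁻ˡ h)) (dec-true (eq? _ _) (sym (gf x (∧-true⁻ˡ h))))
      from : Q y ∧ does (eq? x (g y)) ≡ true → P x ∧ does (eq? y (f x)) ≡ true
      from h with does-true⁻ (eq? x (g y)) (∧-true⁻ʳ h)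
      ... | refl = ∧-true⁺ (QP y (∧-true⁻ˡ h)) (dec-true (eq? _ _) (sym (fg y (∧-true⁻ˡ h))))

count-allFin-suc : ∀ {n} (P : Fin (suc n) → Bool) →
                   count P (allFin (suc n)) ≡ indicator (P fzero) + count (P ∘ fsuc) (allFin n)
count-allFin-suc {n} P =
  trans (count-∷ P fzero _)
        (cong (indicator (P fzero) +_)
              (trans (cong (count P) (sym (map-tabulate id fsuc))) (count-map P fsuc (allFin n))))

allFin-enumerates : ∀ n → Enumerates _≟_ (allFin n)
allFin-enumerates n = enumerates (once′ n)
  where
  once′ : ∀ n (i : Fin n) → occurrences _≟_ i (allFin n) ≡ 1
  once′ (suc n) fzero    = trans (count-allFin-suc {n} (λ y → does (y ≟ fzero)))
                                 (cong suc (count-false (λ _ → refl) (allFin n)))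
  once′ (suc n) (fsuc i) = trans (count-allFin-suc {n} (λ y → does (y ≟ fsuc i))) (once′ n i)

vecs-enumerates : ∀ {A : Set} {eq? : DecidableEquality A} {xs : List A} →
                  Enumerates eq? xs → ∀ n → Enumerates (≡-dec eq?) (vecs xs n)
vecs-enumerates {eq? = eq?} {xs} enum n = enumerates (once′ n)
  where
  open ≡-Reasoning
  once′ : ∀ n (u : Vec _ n) → occurrences (≡-dec eq?) u (vecs xs n) ≡ 1
  once′ 0       []ᵛ      = refl
  once′ (suc n) (x ∷ᵛ w) = begin
    occurrences (≡-dec eq?) (x ∷ᵛ w) (vecs xs (suc n))
      ≡⟨ count-concatMap _ (λ a → map (a ∷ᵛ_) (vecs xs n)) xs ⟩
    sum (map (λ a → count (λ u → does (≡-dec eq? u (x ∷ᵛ w))) (map (a ∷ᵛ_) (vecs xs n))) xs)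
      ≡⟨ sum-map-cong (λ a → count-map _ (a ∷ᵛ_) (vecs xs n)) xs ⟩
    sum (map (λ a → count (λ u → does (eq? a x) ∧ does (≡-dec eq? u w)) (vecs xs n)) xs)
      ≡⟨ sum-map-cong (λ a → count-const-∧ (does (eq? a x)) _ (vecs xs n)) xs ⟩
    sum (map (λ a → if does (eq? a x) then occurrences (≡-dec eq?) w (vecs xs n) else 0) xs)
      ≡⟨ sum-map-cong head-matches xs ⟩
    sum (map (λ a → indicator (does (eq? a x))) xs)
      ≡⟨ count≡sum _ xs ⟨
    occurrences eq? x xs
      ≡⟨ once enum x ⟩
    1 ∎
    where
    head-matches : ∀ a → (if does (eq? a x) then occurrences (≡-dec eq?) w (vecs xs n) else 0)
                         ≡ indicator (does (eq? a x))
    head-matches a with does (eq? a x)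
    ... | true  = once′ n w
    ... | false = refl

_≟ₑ_ : ∀ {n} → DecidableEquality (ESet n)
_≟ₑ_ = ≡-dec (≡-dec _≟ᵇ_)

allESets-enumerates : ∀ n → Enumerates _≟ₑ_ (allESets n)
allESets-enumerates n = vecs-enumerates (vecs-enumerates bools n) n
  where
  bools : Enumerates _≟ᵇ_ (true ∷ false ∷ [])
  bools = enumerates λ { true → refl ; false → refl }

module _ {n : ℕ} where

  all-allFin⁻ : ∀ {p : Fin n → Bool} → all p (allFin n) ≡ true → ∀ i → p i ≡ true
  all-allFin⁻ = all⁻ (allFin-enumerates n)

  all-allFin⁺ : ∀ {p : Fin n → Bool} → (∀ i → p i ≡ true) → all p (allFin n) ≡ true
  all-allFin⁺ p≗true = all⁺ p≗true (allFin n)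

  any-allFin⁺ : ∀ {p : Fin n → Bool} i → p i ≡ true → any p (allFin n) ≡ true
  any-allFin⁺ = any⁺ (allFin-enumerates n)

-- Sets of vertex pairs

module _ {n : ℕ} where

  infix 4 _⊆ₑ_
  _⊆ₑ_ : ESet n → ESet n → Set
  M ⊆ₑ M' = ∀ i j → M ∋ₑ i , j ≡ true → M' ∋ₑ i , j ≡ true

  IsSymmetric : ESet n → Set
  IsSymmetric M = ∀ i j → M ∋ₑ i , j ≡ M ∋ₑ j , i

  mirror : ∀ {M : ESet n} → IsSymmetric M → ∀ {i j} → M ∋ₑ i , j ≡ true → M ∋ₑ j , i ≡ true
  mirror sym-M {i} {j} m = trans (sym (sym-M i j)) m

  ∋ₑ-tabulate : ∀ (f : Fin n → Fin n → Bool) i j → tabulate (λ i → tabulate (f i)) ∋ₑ i , j ≡ f i j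
  ∋ₑ-tabulate f i j rewrite lookup∘tabulate (λ i → tabulate (f i)) i = lookup∘tabulate (f i) j

  ⊆ₑ-antisym : ∀ {M N : ESet n} → M ⊆ₑ N → N ⊆ₑ M → M ≡ N
  ⊆ₑ-antisym {M} {N} M⊆N N⊆M = begin
    M                                              ≡⟨ tabulate∘lookup M ⟨
    tabulate (λ i → lookup M i)                    ≡⟨ tabulate-cong row ⟩
    tabulate (λ i → lookup N i)                    ≡⟨ tabulate∘lookup N ⟩
    N                                              ∎
    where
    open ≡-Reasoning
    row : ∀ i → lookup M i ≡ lookup N i
    row i = trans (sym (tabulate∘lookup (lookup M i)))
                  (trans (tabulate-cong (λ j → true⇔true⇒≡ (M⊆N i j) (N⊆M i j)))
                         (tabulate∘lookup (lookup N i)))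

  insertPair : Fin n → Fin n → ESet n → ESet n
  insertPair v p M = tabulate (λ i → tabulate (λ j →
    M ∋ₑ i , j ∨ (i =ᶠ v ∧ j =ᶠ p) ∨ (i =ᶠ p ∧ j =ᶠ v)))

  data InsertPairView (v p : Fin n) (M : ESet n) (i j : Fin n) : Set where
    old : M ∋ₑ i , j ≡ true → InsertPairView v p M i j
    vp  : i ≡ v → j ≡ p → InsertPairView v p M i j
    pv  : i ≡ p → j ≡ v → InsertPairView v p M i j

  module _ {v p : Fin n} where

    ∋-insertPair⁻ : ∀ {M} i j → insertPair v p M ∋ₑ i , j ≡ true → InsertPairView v p M i j
    ∋-insertPair⁻ {M} i j h with ∨-true⁻ {M ∋ₑ i , j} (trans (sym (∋ₑ-tabulate _ i j)) h)
    ... | inj₁ m = old m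
    ... | inj₂ h′ with ∨-true⁻ {i =ᶠ v ∧ j =ᶠ p} h′
    ...   | inj₁ e = vp (=ᶠ⇒≡ (∧-true⁻ˡ e)) (=ᶠ⇒≡ (∧-true⁻ʳ {i =ᶠ v} e))
    ...   | inj₂ e = pv (=ᶠ⇒≡ (∧-true⁻ˡ e)) (=ᶠ⇒≡ (∧-true⁻ʳ {i =ᶠ p} e))

    ⊆-insertPair : ∀ {M} → M ⊆ₑ insertPair v p M
    ⊆-insertPair {M} i j m = trans (∋ₑ-tabulate _ i j) (∨-true⁺ˡ m)

    insertPair-∋vp : ∀ {M} → insertPair v p M ∋ₑ v , p ≡ true
    insertPair-∋vp {M} = trans (∋ₑ-tabulate _ v p)
      (∨-true⁺ʳ {M ∋ₑ v , p} (∨-true⁺ˡ (∧-true⁺ (=ᶠ-refl v) (=ᶠ-refl p))))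

    insertPair-∋pv : ∀ {M} → insertPair v p M ∋ₑ p , v ≡ true
    insertPair-∋pv {M} = trans (∋ₑ-tabulate _ p v)
      (∨-true⁺ʳ {M ∋ₑ p , v} (∨-true⁺ʳ {p =ᶠ v ∧ v =ᶠ p} (∧-true⁺ (=ᶠ-refl p) (=ᶠ-refl v))))

    insertPair-mono : ∀ {M M'} → M ⊆ₑ M' → insertPair v p M ⊆ₑ insertPair v p M'
    insertPair-mono {M} {M'} M⊆M' i j h with ∋-insertPair⁻ {M} i j h
    ... | old m        = ⊆-insertPair {M'} i j (M⊆M' i j m)
    ... | vp refl refl = insertPair-∋vp {M'}
    ... | pv refl refl = insertPair-∋pv {M'}

    insertPair-⊆ : ∀ {M M'} → IsSymmetric M' → M ⊆ₑ M' → M' ∋ₑ v , p ≡ true → insertPair v p M ⊆ₑ M'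
    insertPair-⊆ {M} {M'} sym-M' M⊆M' m′-vp i j h with ∋-insertPair⁻ {M} i j h
    ... | old m        = M⊆M' i j m
    ... | vp refl refl = m′-vp
    ... | pv refl refl = mirror {M = M'} sym-M' m′-vp

    insertPair-symmetric : ∀ {M} → IsSymmetric M → IsSymmetric (insertPair v p M)
    insertPair-symmetric {M} sym-M i j = true⇔true⇒≡ (flip i j) (flip j i)
      where
      flip : ∀ i j → insertPair v p M ∋ₑ i , j ≡ true → insertPair v p M ∋ₑ j , i ≡ true
      flip i j h with ∋-insertPair⁻ {M} i j h
      ... | old m        = ⊆-insertPair {M} j i (mirror {M = M} sym-M m)
      ... | vp refl refl = insertPair-∋pv {M}
      ... | pv refl refl = insertPair-∋vp {M}

-- Induced matchings

module _ {n : ℕ} (G : Graph n) where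

  covered⁺ : ∀ {M} i j → M ∋ₑ i , j ≡ true → covered G M i ≡ true
  covered⁺ {M} i j m = any-allFin⁺ {p = λ j → M ∋ₑ i , j} j m

  covered⁻ : ∀ {M} i → covered G M i ≡ true → ∃ λ j → M ∋ₑ i , j ≡ true
  covered⁻ {M} i h = any⁻ {p = λ j → M ∋ₑ i , j} (allFin n) h

  covered-insertPair⁻ : ∀ {v p R} k → covered G (insertPair v p R) k ≡ true →
                        covered G R k ≡ true ⊎ k ≡ v ⊎ k ≡ p
  covered-insertPair⁻ {v} {p} {R} k c with covered⁻ {insertPair v p R} k c
  ... | l , h with ∋-insertPair⁻ {M = R} k l h
  ...   | old m  = inj₁ (covered⁺ {R} k l m)
  ...   | vp e _ = inj₂ (inj₁ e)
  ...   | pv e _ = inj₂ (inj₂ e)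

  ∈allV : ∀ i → i ∈ᵇ allV G ≡ true
  ∈allV i = lookup∘tabulate _ i

  record InducedMatching (U : VSet n) (M : ESet n) : Set where
    field
      symmetric : IsSymmetric M
      edge      : ∀ i j → M ∋ₑ i , j ≡ true → adj G i j ≡ true
      inside    : ∀ i j → M ∋ₑ i , j ≡ true → i ∈ᵇ U ≡ true
      induced   : ∀ i j k → M ∋ₑ i , j ≡ true → covered G M k ≡ true → adj G i k ≡ true → k ≡ j

  open InducedMatching

  isInducedMatching⇒ : ∀ {U M} → isInducedMatching G U M ≡ true → InducedMatching U M
  isInducedMatching⇒ {U} {M} h = record
    { symmetric = symm
    ; edge      = λ i j m → ∧-true⁻ˡ (in-G[U] i j m)
    ; inside    = λ i j m → ∧-true⁻ˡ (∧-true⁻ʳ {adj G i j} (in-G[U] i j m))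
    ; induced   = λ i j k m k-covered i~k →
        count≡1⇒unique (allFin-enumerates n) _ (degree-one i (covered⁺ {M} i j m))
                       (∧-true⁺ k-covered i~k) (∧-true⁺ (partner-covered i j m) (∧-true⁻ˡ (in-G[U] i j m)))
    }
    where
    pair : ∀ i j → not (M ∋ₑ i , j xor M ∋ₑ j , i)
                   ∧ (not (M ∋ₑ i , j) ∨ (adj G i j ∧ i ∈ᵇ U ∧ j ∈ᵇ U)) ≡ true
    pair i j = all-allFin⁻ (all-allFin⁻ (∧-true⁻ˡ h) i) j
    symm : IsSymmetric M
    symm i j = xnor-true⁻ (∧-true⁻ˡ (pair i j))
    in-G[U] : ∀ i j → M ∋ₑ i , j ≡ true → adj G i j ∧ i ∈ᵇ U ∧ j ∈ᵇ U ≡ true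
    in-G[U] i j = ⇒-true⁻ (∧-true⁻ʳ {not (M ∋ₑ i , j xor M ∋ₑ j , i)} (pair i j))
    partner-covered : ∀ i j → M ∋ₑ i , j ≡ true → covered G M j ≡ true
    partner-covered i j m = covered⁺ {M} j i (mirror {M = M} symm m)
    degree-one : ∀ i → covered G M i ≡ true → degIn G M i ≡ 1
    degree-one i c = ≡ᵇ⇒≡ _ _ (Equivalence.from T-≡
      (⇒-true⁻ (all-allFin⁻ (∧-true⁻ʳ {isEdgeSetIn G U M} h) i) c))

  ⇒isInducedMatching : ∀ {U M} → InducedMatching U M → isInducedMatching G U M ≡ true
  ⇒isInducedMatching {U} {M} P = ∧-true⁺ edge-set (all-allFin⁺ (λ i → ⇒-true⁺ (degree-one i)))
    where
    edge-set : isEdgeSetIn G U M ≡ true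
    edge-set = all-allFin⁺ λ i → all-allFin⁺ λ j →
      ∧-true⁺ (xnor-true⁺ (symmetric P i j))
              (⇒-true⁺ λ m → ∧-true⁺ (edge P i j m)
                                     (∧-true⁺ (inside P i j m) (inside P j i (mirror {M = M} (symmetric P) m))))
    degree-one : ∀ i → covered G M i ≡ true → (degIn G M i ≡ᵇ 1) ≡ true
    degree-one i c with covered⁻ {M} i c
    ... | j , m = Equivalence.to T-≡ (≡⇒≡ᵇ _ _
      (count-unique (allFin-enumerates n) _ j
        (∧-true⁺ (covered⁺ {M} j i (mirror {M = M} (symmetric P) m)) (edge P i j m))
        (λ k h → induced P i j k m (∧-true⁻ˡ h) (∧-true⁻ʳ {covered G M k} h))))

  InducedMatching-⊆ : ∀ {U M M'} → InducedMatching U M' → IsSymmetric M → M ⊆ₑ M' → InducedMatching U M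
  InducedMatching-⊆ {U} {M} {M'} P′ sym-M M⊆M' = record
    { symmetric = sym-M
    ; edge      = λ i j m → edge P′ i j (M⊆M' i j m)
    ; inside    = λ i j m → inside P′ i j (M⊆M' i j m)
    ; induced   = λ i j k m k-covered → induced P′ i j k (M⊆M' i j m) (still-covered k k-covered)
    }
    where
    still-covered : ∀ k → covered G M k ≡ true → covered G M' k ≡ true
    still-covered k c with covered⁻ {M} k c
    ... | l , m = covered⁺ {M'} k l (M⊆M' k l m)

  InducedMatching-within : ∀ {U U' M} → InducedMatching U M →
                           (∀ i j → M ∋ₑ i , j ≡ true → i ∈ᵇ U' ≡ true) → InducedMatching U' M
  InducedMatching-within P inside′ = record
    { symmetric = symmetric P ; edge = edge P ; inside = inside′ ; induced = induced P }

  InducedMatching-G : ∀ {U M} → InducedMatching U M → InducedMatching (allV G) M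
  InducedMatching-G P = InducedMatching-within P (λ i _ _ → ∈allV i)

  partner-unique : ∀ {U M} → InducedMatching U M → ∀ {i j k} →
                   M ∋ₑ i , j ≡ true → M ∋ₑ i , k ≡ true → k ≡ j
  partner-unique {M = M} P {i} {j} {k} m m′ =
    induced P i j k m (covered⁺ {M} k i (mirror {M = M} (symmetric P) m′)) (edge P i k m′)

  edges-at : ∀ {U M v p} → InducedMatching U M → M ∋ₑ v , p ≡ true → ∀ i j → M ∋ₑ i , j ≡ true →
             (i ≡ v × j ≡ p) ⊎ (i ≡ p × j ≡ v) ⊎ (¬ i ≡ v × ¬ j ≡ v)
  edges-at {M = M} {v} P m-vp i j m with i ≟ v | j ≟ v
  ... | yes refl | _        = inj₁ (refl , partner-unique P m-vp m)
  ... | no _     | yes refl = inj₂ (inj₁ (partner-unique P m-vp (mirror {M = M} (symmetric P) m) , refl))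
  ... | no i≢v   | no j≢v   = inj₂ (inj₂ (i≢v , j≢v))

  module _ {U : VSet n} {M : ESet n} {v : Fin n} (P : InducedMatching U M) (v∉U : v ∈ᵇ U ≡ false) where

    avoids : ∀ {i j} → M ∋ₑ i , j ≡ true → ¬ i ≡ v
    avoids {i} {j} m refl = bool-clash (inside P i j m) v∉U

    avoids′ : ∀ {i j} → M ∋ₑ i , j ≡ true → ¬ j ≡ v
    avoids′ m = avoids (mirror {M = M} (symmetric P) m)

    uncovered-outside : covered G M v ≡ false
    uncovered-outside = ¬true⇒false λ c → avoids (proj₂ (covered⁻ {M} v c)) refl

  ⊂ₑ-true⁺ : ∀ {M M'} → M ⊆ₑ M' → ∀ i j → M' ∋ₑ i , j ≡ true → M ∋ₑ i , j ≡ false → _⊂ₑ_ G M M' ≡ true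
  ⊂ₑ-true⁺ {M} {M'} M⊆M' i j m′ m = ∧-true⁺
    (all-allFin⁺ λ a → all-allFin⁺ λ b → ⇒-true⁺ (M⊆M' a b))
    (any-allFin⁺ i (any-allFin⁺ {p = λ j → M' ∋ₑ i , j ∧ not (M ∋ₑ i , j)} j (∧-true⁺ m′ (cong not m))))

  ⊂ₑ-true⁻ : ∀ {M M'} → _⊂ₑ_ G M M' ≡ true →
             M ⊆ₑ M' × ∃₂ λ i j → M' ∋ₑ i , j ≡ true × M ∋ₑ i , j ≡ false
  ⊂ₑ-true⁻ {M} {M'} h
    with any⁻ (allFin n) (∧-true⁻ʳ {all (λ i → all (λ j → not (M ∋ₑ i , j) ∨ M' ∋ₑ i , j) (allFin n)) (allFin n)} h)
  ... | i , h′ with any⁻ {p = λ j → M' ∋ₑ i , j ∧ not (M ∋ₑ i , j)} (allFin n) h′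
  ...   | j , new = (λ a b → ⇒-true⁻ (all-allFin⁻ (all-allFin⁻ (∧-true⁻ˡ h) a) b))
                  , i , j , ∧-true⁻ˡ new , not-true⁻ (∧-true⁻ʳ {M' ∋ₑ i , j} new)

  record MaximalInducedMatching (U : VSet n) (M : ESet n) : Set where
    field
      inducedMatching : InducedMatching U M
      maximal         : ∀ {M'} → InducedMatching U M' → M ⊆ₑ M' → M' ⊆ₑ M

  open MaximalInducedMatching

  isMaxIM⇒ : ∀ {U M} → isMaxIM G U M ≡ true → MaximalInducedMatching U M
  isMaxIM⇒ {U} {M} h = record { inducedMatching = isInducedMatching⇒ (∧-true⁻ˡ h) ; maximal = maximal′ }
    where
    maximal′ : ∀ {M'} → InducedMatching U M' → M ⊆ₑ M' → M' ⊆ₑ M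
    maximal′ {M'} P′ M⊆M' i j m′ with M ∋ₑ i , j in m
    ... | true  = refl
    ... | false = ⊥-elim (bool-clash (∧-true⁺ (⇒isInducedMatching P′) (⊂ₑ-true⁺ {M} {M'} M⊆M' i j m′ m))
      (not-true⁻ (all⁻ (allESets-enumerates n) (∧-true⁻ʳ {isInducedMatching G U M} h) M')))

  ⇒isMaxIM : ∀ {U M} → MaximalInducedMatching U M → isMaxIM G U M ≡ true
  ⇒isMaxIM {U} {M} P = ∧-true⁺ (⇒isInducedMatching (inducedMatching P)) (all⁺ no-larger (allESets n))
    where
    no-larger : ∀ M' → not (isInducedMatching G U M' ∧ _⊂ₑ_ G M M') ≡ true
    no-larger M' with isInducedMatching G U M' in im | _⊂ₑ_ G M M' in sub
    ... | false | _     = refl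
    ... | true  | false = refl
    ... | true  | true  with ⊂ₑ-true⁻ {M} {M'} sub
    ...   | M⊆M' , i , j , m′ , m = ⊥-elim (bool-clash (maximal P (isInducedMatching⇒ {U} {M'} im) M⊆M' i j m′) m)

  module _ {v : Fin n} {M : ESet n} where

    ∋-removeAt⁻ : ∀ i j → removeAt G v M ∋ₑ i , j ≡ true → M ∋ₑ i , j ≡ true × ¬ i ≡ v × ¬ j ≡ v
    ∋-removeAt⁻ i j h = ∧-true⁻ˡ h′
                      , =ᶠ-false⇒≢ (not-true⁻ (∧-true⁻ˡ h″))
                      , =ᶠ-false⇒≢ (not-true⁻ (∧-true⁻ʳ {not (i =ᶠ v)} h″))
      where
      h′ : M ∋ₑ i , j ∧ not (i =ᶠ v) ∧ not (j =ᶠ v) ≡ true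
      h′ = trans (sym (∋ₑ-tabulate (λ i j → M ∋ₑ i , j ∧ not (i =ᶠ v) ∧ not (j =ᶠ v)) i j)) h
      h″ : not (i =ᶠ v) ∧ not (j =ᶠ v) ≡ true
      h″ = ∧-true⁻ʳ {M ∋ₑ i , j} h′

    ∋-removeAt⁺ : ∀ i j → M ∋ₑ i , j ≡ true → ¬ i ≡ v → ¬ j ≡ v → removeAt G v M ∋ₑ i , j ≡ true
    ∋-removeAt⁺ i j m i≢v j≢v = trans (∋ₑ-tabulate _ i j)
      (∧-true⁺ m (∧-true⁺ (cong not (≢⇒=ᶠ-false i≢v)) (cong not (≢⇒=ᶠ-false j≢v))))

    removeAt-⊆ : removeAt G v M ⊆ₑ M
    removeAt-⊆ i j h = proj₁ (∋-removeAt⁻ i j h)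

    removeAt-symmetric : IsSymmetric M → IsSymmetric (removeAt G v M)
    removeAt-symmetric sym-M i j = true⇔true⇒≡ (flip i j) (flip j i)
      where
      flip : ∀ i j → removeAt G v M ∋ₑ i , j ≡ true → removeAt G v M ∋ₑ j , i ≡ true
      flip i j h with ∋-removeAt⁻ i j h
      ... | m , i≢v , j≢v = ∋-removeAt⁺ j i (mirror {M = M} sym-M m) j≢v i≢v

  removeAt-InducedMatching : ∀ {U U' M v} → InducedMatching U M →
                             (∀ {i} → i ∈ᵇ U ≡ true → ¬ i ≡ v → i ∈ᵇ U' ≡ true) →
                             InducedMatching U' (removeAt G v M)
  removeAt-InducedMatching {M = M} {v} P U⇒U' = InducedMatching-within
    (InducedMatching-⊆ P (removeAt-symmetric {v} {M} (symmetric P)) (removeAt-⊆ {v} {M}))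
    (λ i j h → let m , i≢v , _ = ∋-removeAt⁻ {v} {M} i j h in U⇒U' (inside P i j m) i≢v)

  ⊆-removeAt : ∀ {U M M' v} → InducedMatching U M → v ∈ᵇ U ≡ false → M ⊆ₑ M' → M ⊆ₑ removeAt G v M'
  ⊆-removeAt {M' = M'} P v∉U M⊆M' i j m = ∋-removeAt⁺ {M = M'} i j (M⊆M' i j m) (avoids P v∉U m) (avoids′ P v∉U m)

  removeAt-insertPair : ∀ {U M v p} → InducedMatching U M → v ∈ᵇ U ≡ false →
                        removeAt G v (insertPair v p M) ≡ M
  removeAt-insertPair {M = M} {v} {p} P v∉U = ⊆ₑ-antisym removed (⊆-removeAt {M' = insertPair v p M} P v∉U (⊆-insertPair {M = M}))
    where
    removed : removeAt G v (insertPair v p M) ⊆ₑ M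
    removed i j h with ∋-removeAt⁻ {v} {insertPair v p M} i j h
    ... | h′ , i≢v , j≢v with ∋-insertPair⁻ {M = M} i j h′
    ...   | old m    = m
    ...   | vp i≡v _ = ⊥-elim (i≢v i≡v)
    ...   | pv _ j≡v = ⊥-elim (j≢v j≡v)

  insertPair-removeAt : ∀ {U M v p} → InducedMatching U M → M ∋ₑ v , p ≡ true →
                        insertPair v p (removeAt G v M) ≡ M
  insertPair-removeAt {M = M} {v} {p} P m-vp = ⊆ₑ-antisym restored complete
    where
    restored : insertPair v p (removeAt G v M) ⊆ₑ M
    restored = insertPair-⊆ {v = v} {p = p} {M = removeAt G v M} {M' = M} (symmetric P) (removeAt-⊆ {v} {M}) m-vp
    complete : M ⊆ₑ insertPair v p (removeAt G v M)
    complete i j m with edges-at P m-vp i j m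
    ... | inj₁ (refl , refl)          = insertPair-∋vp {M = removeAt G v M}
    ... | inj₂ (inj₁ (refl , refl))   = insertPair-∋pv {M = removeAt G v M}
    ... | inj₂ (inj₂ (i≢v , j≢v))     = ⊆-insertPair {M = removeAt G v M} i j (∋-removeAt⁺ {v} {M} i j m i≢v j≢v)

  insertPair-maximal : ∀ {U R v p} → MaximalInducedMatching U R → v ∈ᵇ U ≡ false →
                       InducedMatching (allV G) (insertPair v p R) →
                       (∀ {M} → InducedMatching (allV G) M → M ∋ₑ v , p ≡ true →
                                InducedMatching U (removeAt G v M)) →
                       MaximalInducedMatching (allV G) (insertPair v p R)
  insertPair-maximal {U} {R} {v} {p} P v∉U P+ restrict = record { inducedMatching = P+ ; maximal = maximal+ }
    where
    maximal+ : ∀ {M} → InducedMatching (allV G) M → insertPair v p R ⊆ₑ M → M ⊆ₑ insertPair v p R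
    -- M = (M - v) + vp, and M - v ⊆ R by the maximality of R.
    maximal+ {M} P′ R+⊆M = subst (_⊆ₑ insertPair v p R) (insertPair-removeAt P′ m-vp)
                                 (insertPair-mono {M = removeAt G v M} {R} (maximal P (restrict P′ m-vp) R⊆M-v))
      where
      m-vp : M ∋ₑ v , p ≡ true
      m-vp = R+⊆M v p (insertPair-∋vp {M = R})
      R⊆M-v : R ⊆ₑ removeAt G v M
      R⊆M-v = ⊆-removeAt {M' = M} (inducedMatching P) v∉U (λ i j m → R+⊆M i j (⊆-insertPair {M = R} i j m))

  module _ (v : Fin n) where

    V-v : VSet n
    V-v = minus G (single G v)

    v∉V-v : v ∈ᵇ V-v ≡ false
    v∉V-v = trans (lookup∘tabulate _ v) (cong not (trans (lookup∘tabulate _ v) (=ᶠ-refl v)))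

    ∈V-v⁺ : ∀ {i} → ¬ i ≡ v → i ∈ᵇ V-v ≡ true
    ∈V-v⁺ {i} i≢v = trans (lookup∘tabulate _ i) (cong not (trans (lookup∘tabulate _ i) (≢⇒=ᶠ-false i≢v)))

    uncovered⇒InducedMatching-G-v : ∀ {U M} → InducedMatching U M → covered G M v ≡ false →
                                     InducedMatching V-v M
    uncovered⇒InducedMatching-G-v {M = M} P uncovered = InducedMatching-within P
      (λ i j m → ∈V-v⁺ λ { refl → bool-clash (covered⁺ {M} v j m) uncovered })

    uncovered⇒maximal-in-G-v : ∀ {M} → MaximalInducedMatching (allV G) M → covered G M v ≡ false →
                               MaximalInducedMatching V-v M
    uncovered⇒maximal-in-G-v P uncovered = record
      { inducedMatching = uncovered⇒InducedMatching-G-v (inducedMatching P) uncovered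
      ; maximal         = λ P′ → maximal P (InducedMatching-G P′)
      }

    -- The hypothesis says that no matching is counted by β(v;G).
    maximal-in-G-v⇒maximal : (∀ M → inMv G v M ∧ isMaxIM G V-v (removeAt G v M) ≡ false) →
                             ∀ {M} → MaximalInducedMatching V-v M → MaximalInducedMatching (allV G) M
    maximal-in-G-v⇒maximal no-β {M} P = record
      { inducedMatching = InducedMatching-G (inducedMatching P) ; maximal = maximal′ }
      where
      maximal′ : ∀ {M'} → InducedMatching (allV G) M' → M ⊆ₑ M' → M' ⊆ₑ M
      maximal′ {M'} P′ M⊆M' with covered G M' v in c
      ... | false = maximal P (uncovered⇒InducedMatching-G-v P′ c) M⊆M'
      ... | true with covered⁻ {M'} v c
      ...   | p , m′-vp = ⊥-elim (bool-clash counted-by-β (no-β M+))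
        where
        M+ : ESet n
        M+ = insertPair v p M
        M+⊆M' : M+ ⊆ₑ M'
        M+⊆M' = insertPair-⊆ {v = v} {p = p} {M = M} {M' = M'} (symmetric P′) M⊆M' m′-vp
        M+-maximal : MaximalInducedMatching (allV G) M+
        M+-maximal = insertPair-maximal P v∉V-v
          (InducedMatching-⊆ P′ (insertPair-symmetric {M = M} (symmetric (inducedMatching P))) M+⊆M')
          (λ P″ _ → removeAt-InducedMatching P″ (λ _ → ∈V-v⁺))
        counted-by-β : inMv G v M+ ∧ isMaxIM G V-v (removeAt G v M+) ≡ true
        counted-by-β = ∧-true⁺ (∧-true⁺ (⇒isMaxIM M+-maximal) (covered⁺ {M+} v p (insertPair-∋vp {M = M})))
          (subst (λ X → isMaxIM G V-v X ≡ true) (sym (removeAt-insertPair (inducedMatching P) v∉V-v)) (⇒isMaxIM P))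

    numMIM-G-v≡uncovered : (∀ M → inMv G v M ∧ isMaxIM G V-v (removeAt G v M) ≡ false) →
                           numMIM G V-v ≡ count (λ M → isMaxIM G (allV G) M ∧ not (covered G M v)) (allESets n)
    numMIM-G-v≡uncovered no-β = count-cong (λ M → true⇔true⇒≡ (to M) (from M)) (allESets n)
      where
      to : ∀ M → isMaxIM G V-v M ≡ true → isMaxIM G (allV G) M ∧ not (covered G M v) ≡ true
      to M h = ∧-true⁺ (⇒isMaxIM (maximal-in-G-v⇒maximal no-β P))
                       (cong not (uncovered-outside (inducedMatching P) v∉V-v))
        where P = isMaxIM⇒ {M = M} h
      from : ∀ M → isMaxIM G (allV G) M ∧ not (covered G M v) ≡ true → isMaxIM G V-v M ≡ true
      from M h = ⇒isMaxIM (uncovered⇒maximal-in-G-v (isMaxIM⇒ {M = M} (∧-true⁻ˡ h))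
                                                   (not-true⁻ (∧-true⁻ʳ {isMaxIM G (allV G) M} h)))

    remoteSet : Fin n → VSet n
    remoteSet p = minus G (_∪ᵥ_ G (closedN G v) (closedN G p))

    record Remote (p i : Fin n) : Set where
      field
        ≢v : ¬ i ≡ v
        ≁v : adj G v i ≡ false
        ≢p : ¬ i ≡ p
        ≁p : adj G p i ≡ false

    ∈remoteSet≡ : ∀ p i → i ∈ᵇ remoteSet p ≡ not ((i =ᶠ v ∨ adj G v i) ∨ (i =ᶠ p ∨ adj G p i))
    ∈remoteSet≡ p i = trans (lookup∘tabulate _ i) (cong not (trans (lookup∘tabulate _ i)
                        (cong₂ _∨_ (lookup∘tabulate _ i) (lookup∘tabulate _ i))))

    ∈remoteSet⁻ : ∀ {p i} → i ∈ᵇ remoteSet p ≡ true → Remote p i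
    ∈remoteSet⁻ {p} {i} h =
      let near-v , near-p = ∨-false⁻ (not-true⁻ (trans (sym (∈remoteSet≡ p i)) h))
          ≢v , ≁v = ∨-false⁻ near-v
          ≢p , ≁p = ∨-false⁻ near-p
      in record { ≢v = =ᶠ-false⇒≢ ≢v ; ≁v = ≁v ; ≢p = =ᶠ-false⇒≢ ≢p ; ≁p = ≁p }

    ∈remoteSet⁺ : ∀ {p i} → Remote p i → i ∈ᵇ remoteSet p ≡ true
    ∈remoteSet⁺ {p} {i} r = trans (∈remoteSet≡ p i) (cong not (∨-false⁺
      (∨-false⁺ (≢⇒=ᶠ-false (Remote.≢v r)) (Remote.≁v r))
      (∨-false⁺ (≢⇒=ᶠ-false (Remote.≢p r)) (Remote.≁p r))))

    v∉remoteSet : ∀ p → v ∈ᵇ remoteSet p ≡ false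
    v∉remoteSet p = ¬true⇒false λ h → Remote.≢v (∈remoteSet⁻ h) refl

    removeAt-remote : ∀ {U M p} → InducedMatching U M → M ∋ₑ v , p ≡ true →
                      InducedMatching (remoteSet p) (removeAt G v M)
    removeAt-remote {M = M} {p} P m-vp = InducedMatching-within
      (removeAt-InducedMatching {U' = allV G} P (λ _ _ → ∈allV _))
      (λ i j h → let m , i≢v , j≢v = ∋-removeAt⁻ {v} {M} i j h in ∈remoteSet⁺ (remote m i≢v j≢v))
      where
      remote : ∀ {i j} → M ∋ₑ i , j ≡ true → ¬ i ≡ v → ¬ j ≡ v → Remote p i
      remote {i} {j} m i≢v j≢v = record { ≢v = i≢v ; ≁v = ¬true⇒false v≁i ; ≢p = i≢p ; ≁p = ¬true⇒false p≁i }
        where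
        m-pv : M ∋ₑ p , v ≡ true
        m-pv = mirror {M = M} (symmetric P) m-vp
        i≢p : ¬ i ≡ p
        i≢p refl = j≢v (partner-unique P m-pv m)
        v≁i : ¬ adj G v i ≡ true
        v≁i v~i = i≢p (induced P v p i m-vp (covered⁺ {M} i j m) v~i)
        p≁i : ¬ adj G p i ≡ true
        p≁i p~i = i≢v (induced P p v i m-pv (covered⁺ {M} i j m) p~i)

    insertPair-remote : ∀ {p R} → adj G v p ≡ true → InducedMatching (remoteSet p) R →
                        InducedMatching (allV G) (insertPair v p R)
    insertPair-remote {p} {R} v~p P = record
      { symmetric = insertPair-symmetric {M = R} (symmetric P)
      ; edge      = edge+
      ; inside    = λ i _ _ → ∈allV i
      ; induced   = induced+
      }
      where
      remote : ∀ {i j} → R ∋ₑ i , j ≡ true → Remote p i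
      remote {i} {j} m = ∈remoteSet⁻ (inside P i j m)
      remote-covered : ∀ {k} → covered G R k ≡ true → Remote p k
      remote-covered {k} c = remote (proj₂ (covered⁻ {R} k c))
      edge+ : ∀ i j → insertPair v p R ∋ₑ i , j ≡ true → adj G i j ≡ true
      edge+ i j h with ∋-insertPair⁻ {M = R} i j h
      ... | old m        = edge P i j m
      ... | vp refl refl = v~p
      ... | pv refl refl = trans (Graph.sym G p v) v~p
      induced+ : ∀ i j k → insertPair v p R ∋ₑ i , j ≡ true → covered G (insertPair v p R) k ≡ true →
                 adj G i k ≡ true → k ≡ j
      induced+ i j k h c i~k with ∋-insertPair⁻ {M = R} i j h | covered-insertPair⁻ {v} {p} {R} k c
      ... | old m        | inj₁ c′          = induced P i j k m c′ i~k
      ... | old m        | inj₂ (inj₁ refl) = ⊥-elim (bool-clash (trans (Graph.sym G v i) i~k) (Remote.≁v (remote m)))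
      ... | old m        | inj₂ (inj₂ refl) = ⊥-elim (bool-clash (trans (Graph.sym G p i) i~k) (Remote.≁p (remote m)))
      ... | vp refl refl | inj₁ c′          = ⊥-elim (bool-clash i~k (Remote.≁v (remote-covered c′)))
      ... | vp refl refl | inj₂ (inj₁ refl) = ⊥-elim (bool-clash i~k (irrefl G v))
      ... | vp refl refl | inj₂ (inj₂ refl) = refl
      ... | pv refl refl | inj₁ c′          = ⊥-elim (bool-clash i~k (Remote.≁p (remote-covered c′)))
      ... | pv refl refl | inj₂ (inj₁ refl) = refl
      ... | pv refl refl | inj₂ (inj₂ refl) = ⊥-elim (bool-clash i~k (irrefl G p))

    removeAt-maximal : ∀ {M p} → MaximalInducedMatching (allV G) M → M ∋ₑ v , p ≡ true →
                       MaximalInducedMatching (remoteSet p) (removeAt G v M)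
    removeAt-maximal {M} {p} P m-vp = record
      { inducedMatching = removeAt-remote (inducedMatching P) m-vp ; maximal = maximal′ }
      where
      maximal′ : ∀ {R} → InducedMatching (remoteSet p) R → removeAt G v M ⊆ₑ R → R ⊆ₑ removeAt G v M
      maximal′ {R} P′ M-v⊆R = ⊆-removeAt {M' = M} P′ (v∉remoteSet p) λ i j r →
        maximal P (insertPair-remote (edge (inducedMatching P) v p m-vp) P′)
                  (subst (_⊆ₑ insertPair v p R) (insertPair-removeAt (inducedMatching P) m-vp)
                         (insertPair-mono {M = removeAt G v M} {R} M-v⊆R))
                  i j (⊆-insertPair {M = R} i j r)

    insertPair-maximal-remote : ∀ {p R} → adj G v p ≡ true → MaximalInducedMatching (remoteSet p) R →
                                MaximalInducedMatching (allV G) (insertPair v p R)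
    insertPair-maximal-remote {p} v~p P = insertPair-maximal P (v∉remoteSet p)
      (insertPair-remote v~p (inducedMatching P)) removeAt-remote

    count-through≡numMIM : ∀ p → adj G v p ≡ true →
                           count (λ M → inMv G v M ∧ M ∋ₑ v , p) (allESets n) ≡ numMIM G (remoteSet p)
    count-through≡numMIM p v~p = count-bijection (allESets-enumerates n) _ _ (removeAt G v) (insertPair v p)
      (λ M h → ⇒isMaxIM (removeAt-maximal (isMaxIM⇒ {allV G} {M} (∧-true⁻ˡ (∧-true⁻ˡ h))) (∧-true⁻ʳ {inMv G v M} h)))
      (λ R h → ∧-true⁺ (∧-true⁺ (⇒isMaxIM (insertPair-maximal-remote v~p (isMaxIM⇒ {remoteSet p} {R} h)))
                                (covered⁺ {insertPair v p R} v p (insertPair-∋vp {M = R})))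
                       (insertPair-∋vp {M = R}))
      (λ M h → insertPair-removeAt (inducedMatching (isMaxIM⇒ {allV G} {M} (∧-true⁻ˡ (∧-true⁻ˡ h))))
                                   (∧-true⁻ʳ {inMv G v M} h))
      (λ R h → removeAt-insertPair (inducedMatching (isMaxIM⇒ {remoteSet p} {R} h)) (v∉remoteSet p))

    numMv≡sumTerm : numMv G v ≡ sumTerm G v
    numMv≡sumTerm = begin
      count (inMv G v) (allESets n)
        ≡⟨ count-partition (inMv G v) (λ p M → M ∋ₑ v , p) (allESets n) N[v] one-partner ⟩
      sum (map (λ p → count (λ M → inMv G v M ∧ M ∋ₑ v , p) (allESets n)) N[v])
        ≡⟨ sum-map-filterᵇ (adj G v) _ (allFin n) ⟩
      sum (map (λ p → if adj G v p then count (λ M → inMv G v M ∧ M ∋ₑ v , p) (allESets n) else 0) (allFin n))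
        ≡⟨ sum-map-cong through (allFin n) ⟩
      sum (map (λ p → if adj G v p then numMIM G (remoteSet p) else 0) (allFin n))
        ≡⟨ sum-map-filterᵇ (adj G v) _ (allFin n) ⟨
      sumTerm G v
        ∎
      where
      open ≡-Reasoning
      N[v] : List (Fin n)
      N[v] = filterᵇ (adj G v) (allFin n)
      one-partner : ∀ M → inMv G v M ≡ true → count (λ p → M ∋ₑ v , p) N[v] ≡ 1
      one-partner M h with covered⁻ {M} v (∧-true⁻ʳ {isMaxIM G (allV G) M} h)
      ... | p , m = trans (count-filterᵇ (adj G v) _ (allFin n))
        (count-unique (allFin-enumerates n) _ p (∧-true⁺ (edge P v p m) m)
                      (λ k h → partner-unique P m (∧-true⁻ʳ {adj G v k} h)))
        where P = inducedMatching (isMaxIM⇒ {allV G} {M} (∧-true⁻ˡ h))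
      through : ∀ p → (if adj G v p then count (λ M → inMv G v M ∧ M ∋ₑ v , p) (allESets n) else 0)
                      ≡ (if adj G v p then numMIM G (remoteSet p) else 0)
      through p with adj G v p in v~p
      ... | true  = count-through≡numMIM p v~p
      ... | false = refl

corollary2p1 : ∀ {n : ℕ} (G : Graph n) (v : Fin n) → β G v ≡ 0 →
    (numMIM-G G ≡ numMIM G (minus G (single G v)) + α G v)
    × (numMIM-G G ≡ numMIM G (minus G (single G v)) + sumTerm G v)
corollary2p1 {n} G v β≡0 = via-α , via-sum
  where
  uncovered : ℕ
  uncovered = count (λ M → isMaxIM G (allV G) M ∧ not (covered G M v)) (allESets n)
  by-v : numMIM-G G ≡ numMv G v + uncovered
  by-v = count-split (isMaxIM G (allV G)) (λ M → covered G M v) (allESets n)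
  G-v : numMIM G (minus G (single G v)) ≡ uncovered
  G-v = numMIM-G-v≡uncovered G v (count≡0⇒false (allESets-enumerates n) β≡0)
  numMv≡α : numMv G v ≡ α G v
  numMv≡α = trans (count-split (inMv G v) (λ M → isMaxIM G (V-v G v) (removeAt G v M)) (allESets n))
                  (cong (_+ α G v) β≡0)
  via-α : numMIM-G G ≡ numMIM G (minus G (single G v)) + α G v
  via-α = trans by-v (trans (+-comm (numMv G v) uncovered) (cong₂ _+_ (sym G-v) numMv≡α))
  via-sum : numMIM-G G ≡ numMIM G (minus G (single G v)) + sumTerm G v
  via-sum = trans by-v (trans (+-comm (numMv G v) uncovered) (cong₂ _+_ (sym G-v) (numMv≡sumTerm G v)))
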